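{- For any partitions $\lambda^{(1)},\ldots,\lambda^{(N)}$, the product of Schur functions $s_{\lambda^{(1)}}s_{\lambda^{(2)}}\cdots s_{\lambda^{(N)}}\in\mathsf{Sym}$ has saturated Newton polytope.
   Context: $\mathsf{Sym}$ is the ring of symmetric functions in $x_1,x_2,\ldots$; $s_\lambda$ is the Schur function. For a polynomial $g=\sum c_\alpha x^\alpha$ in $x_1,\ldots,x_m$, $\mathsf{Newton}(g)=\mathrm{conv}\{\alpha:c_\alpha\neq0\}\subseteq\mathbb{R}^m$ and $g$ has saturated Newton polytope (SNP) if every lattice point of $\mathsf{Newton}(g)$ is an exponent vector with nonzero coefficient. An element $f\in\mathsf{Sym}$ is SNP if its specialization $f(x_1,\ldots,x_m)$ (setting $x_i=0$ for $i>m$) is SNP for every $m\geq 1$.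
   Formalization: Lattice points of the Newton polytope are those expressible as convex combinations of exponent vectors with nonzero coefficient using rational weights, rather than as points of the real convex hull in $\mathbb{R}^m$. -}

module Defs where

open import Data.Nat using (ℕ; zero; suc; _+_; _≤_; _<_)
open import Data.Fin using (Fin; toℕ) renaming (zero to fzero; suc to fsuc)
import Data.Fin as F
open import Data.List using (List; []; _∷_)
open import Data.List.Relation.Unary.Linked using (Linked)
open import Data.List.Relation.Unary.All using (All)
open import Data.Vec using (Vec; []; _∷_; replicate; zipWith; tabulate)
import Data.Vec as V
open import Data.Integer using (ℤ; +_)
open import Data.Rational using (ℚ; 0ℚ; 1ℚ; _+_; _*_; _≤_)
import Data.Rational as Q
open import Data.Product using (Σ; _×_; ∃)
open import Data.Unit using (⊤)
open import Relation.Binary.PropositionalEquality using (_≡_)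
open import Relation.Nullary using (yes; no)

record Partition : Set where
  constructor mkPartition
  field
    parts    : List ℕ
    decr     : Linked (λ a b → b Data.Nat.≤ a) parts
    positive : All (λ a → 0 Data.Nat.< a) parts
open Partition public

-- i-th part (0-indexed), 0 beyond the length
part : List ℕ → ℕ → ℕ
part []       _       = 0
part (r ∷ _)  zero    = r
part (_ ∷ rs) (suc i) = part rs i

Cell : List ℕ → ℕ → ℕ → Set
Cell rs i j = j Data.Nat.< part rs i

-- Fillings of a Young diagram with entries in [m] (Fin m encodes 1..m)

Filling : ℕ → List ℕ → Set
Filling m []       = ⊤
Filling m (r ∷ rs) = Vec (Fin m) r × Filling m rs

lookupRow : ∀ {m r} → Vec (Fin m) r → ℕ → ℕ
lookupRow []       _       = 0
lookupRow (x ∷ _)  zero    = toℕ x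
lookupRow (_ ∷ xs) (suc j) = lookupRow xs j

-- entry in cell (i , j) (as a natural number; 0 off the diagram, never used there)
entry : ∀ {m} (rs : List ℕ) → Filling m rs → ℕ → ℕ → ℕ
entry []       _          _       _ = 0
entry (r ∷ rs) (row Data.Product., _) zero    j = lookupRow row j
entry (r ∷ rs) (_ Data.Product., t)   (suc i) j = entry rs t i j

IsSemistandard : ∀ {m} (rs : List ℕ) → Filling m rs → Set
IsSemistandard rs T =
  (∀ i j → Cell rs i (suc j) → entry rs T i j Data.Nat.≤ entry rs T i (suc j)) ×
  (∀ i j → Cell rs (suc i) j → entry rs T i j Data.Nat.< entry rs T (suc i) j)

SSYT : ℕ → Partition → Set
SSYT m lam = Σ (Filling m (parts lam)) (IsSemistandard (parts lam))

countRow : ∀ {m r} → Fin m → Vec (Fin m) r → ℕ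
countRow k [] = 0
countRow k (x ∷ xs) with k F.≟ x
... | yes _ = suc (countRow k xs)
... | no  _ = countRow k xs

contentF : ∀ {m} (rs : List ℕ) → Filling m rs → Vec ℕ m
contentF {m} []       _                       = replicate m 0
contentF {m} (r ∷ rs) (row Data.Product., t)  =
  zipWith Data.Nat._+_ (tabulate (λ k → countRow k row)) (contentF rs t)

content : ∀ {m} (λ' : Partition) → SSYT m λ' → Vec ℕ m
content λ' (T Data.Product., _) = contentF (parts λ') T

-- Polynomials in x_1..x_m with nonnegative integer coefficients, presented
-- as a type of "monomial terms" Mon with an exponent map: the coefficient
-- of x^α is the number of terms with exponent α.  E.g. the Schur polynomial
-- s_λ(x_1..x_m) = Σ_{T ∈ SSYT(λ,[m])} x^{content T}.

InSupport : ∀ {m} {Mon : Set} → (Mon → Vec ℕ m) → Vec ℤ m → Set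
InSupport {Mon = Mon} exp α = Σ Mon (λ t → V.map +_ (exp t) ≡ α)

ProductTerm : (m N : ℕ) → (Fin N → Partition) → Set
ProductTerm m N lams = (i : Fin N) → SSYT m (lams i)

sumVecs : ∀ {m} (N : ℕ) → (Fin N → Vec ℕ m) → Vec ℕ m
sumVecs {m} zero    v = replicate m 0
sumVecs {m} (suc N) v = zipWith Data.Nat._+_ (v fzero) (sumVecs N (λ i → v (fsuc i)))

productExp : (m N : ℕ) (lams : Fin N → Partition) → ProductTerm m N lams → Vec ℕ m
productExp m N lams T = sumVecs N (λ i → content (lams i) (T i))

sumℚ : (k : ℕ) → (Fin k → ℚ) → ℚ
sumℚ zero    w = 0ℚ
sumℚ (suc k) w = w fzero Q.+ sumℚ k (λ j → w (fsuc j))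

InConvexHull : ∀ {m} → (Vec ℤ m → Set) → Vec ℤ m → Set
InConvexHull {m} S α =
  Σ ℕ λ k → Σ (Fin k → Vec ℤ m) λ p → Σ (Fin k → ℚ) λ w →
    (∀ j → S (p j)) ×
    (∀ j → 0ℚ Q.≤ w j) ×
    (sumℚ k w ≡ 1ℚ) ×
    (∀ (c : Fin m) → sumℚ k (λ j → w j Q.* (V.lookup (p j) c Q./ 1)) ≡ (V.lookup α c Q./ 1))

HasSNP : ∀ {m} {Mon : Set} → (Mon → Vec ℕ m) → Set
HasSNP {m} exp = ∀ (α : Vec ℤ m) → InConvexHull (InSupport exp) α → InSupport exp α

{-# OPTIONS --safe #-}
module Submission where

-- Write ν for the row-wise sum λ(1) + ⋯ + λ(N) of the shapes. Every exponent vector β of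
-- s_λ(1) ⋯ s_λ(N) in m variables is dominated by ν: for every set S of colours, a tuple of
-- tableaux has at most ν 0 + ⋯ + ν (∣S∣ - 1) entries from S. This follows by induction on m,
-- since the cells holding the largest letter form a horizontal strip. Dominance is a system
-- of linear inequalities, so it persists on the rational convex hull of the support.
-- Conversely every β ∈ ℕᵐ dominated by ν is the weight of a tuple of tableaux: push the β m
-- copies of the largest letter as low as possible into horizontal strips of the shapes; what
-- remains of β is dominated by what remains of ν, and we recurse.

open import Defs
open import Data.Nat
  using (ℕ; zero; suc; _+_; _∸_; _⊓_; _≤_; _<_; _≥_; z≤n; s≤s; s≤s⁻¹; z<s; s<s; _≟_; _<?_; _≤?_)
open import Data.Nat.Properties
open import Data.Fin using (Fin; toℕ; fromℕ<) renaming (zero to fzero; suc to fsuc)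
import Data.Fin as F
open import Data.Fin.Properties using (toℕ<n; toℕ-fromℕ<; toℕ-injective)
open import Data.List using ([]; _∷_; length)
open import Data.List.Relation.Unary.Linked using (Linked; []; [-]; _∷_)
open import Data.Vec using (Vec; []; _∷_; lookup; map; tabulate; zipWith)
open import Data.Vec.Properties
  using (lookup-map; lookup-replicate; lookup-zipWith; lookup∘tabulate; tabulate∘lookup; tabulate-cong)
open import Data.Unit using (tt)
open import Data.Integer as ℤ using (ℤ) renaming (+_ to pos)
open import Data.Bool using (Bool; true; false; if_then_else_)
open import Data.Empty using (⊥-elim)
open import Data.Sum using (inj₁; inj₂)
open import Data.Product using (Σ; _×_; _,_; proj₁; proj₂)
open import Function using (_∘_; _⇔_; mk⇔; Equivalence)
open import Relation.Nullary using (Dec; yes; no; ¬_)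
open import Relation.Binary.PropositionalEquality
open import Algebra.Properties.Semiring.Sum +-*-semiring
  using (sum; sum-cong-≗; ∑-distrib-+; ∑-comm; sum-replicate-zero)
open import Algebra.Properties.CommutativeSemigroup +-commutativeSemigroup
  using () renaming (interchange to +-interchange)
open import Algebra.Bundles using (CommutativeRing)
import Algebra.Properties.Semiring.Sum
open import Data.Rational as ℚ using (ℚ; mkℚ; 0ℚ; 1ℚ; *≤*; ↥_)
import Data.Rational.Properties as ℚP
import Data.Integer.Properties as ℤP
open import Data.Nat.Coprimality as Coprimality using (1-coprimeTo)
open import Algebra.Properties.CommutativeSemigroup (CommutativeRing.*-commutativeSemigroup ℚP.+-*-commutativeRing)
  using (x∙yz≈y∙xz)

-- Finite sums

sum-mono-≤ : ∀ {n} {f g : Fin n → ℕ} → (∀ i → f i ≤ g i) → sum f ≤ sum g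
sum-mono-≤ {zero}  f≤g = z≤n
sum-mono-≤ {suc n} f≤g = +-mono-≤ (f≤g fzero) (sum-mono-≤ (f≤g ∘ fsuc))

≤-sum : ∀ {n} (f : Fin n → ℕ) i → f i ≤ sum f
≤-sum f fzero    = m≤m+n (f fzero) _
≤-sum f (fsuc i) = ≤-trans (≤-sum (f ∘ fsuc) i) (m≤n+m _ (f fzero))

sum≡0⇒≡0 : ∀ {n} (f : Fin n → ℕ) → sum f ≡ 0 → ∀ i → f i ≡ 0
sum≡0⇒≡0 f eq fzero    = m+n≡0⇒m≡0 (f fzero) eq
sum≡0⇒≡0 f eq (fsuc i) = sum≡0⇒≡0 (f ∘ fsuc) (m+n≡0⇒n≡0 (f fzero) eq) i

∑< : ℕ → (ℕ → ℕ) → ℕ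
∑< n f = sum {n} (λ i → f (toℕ i))

∑<-cong : ∀ n {f g : ℕ → ℕ} → (∀ i → i < n → f i ≡ g i) → ∑< n f ≡ ∑< n g
∑<-cong n f≡g = sum-cong-≗ (λ i → f≡g (toℕ i) (toℕ<n i))

∑<-mono-≤ : ∀ n {f g : ℕ → ℕ} → (∀ i → i < n → f i ≤ g i) → ∑< n f ≤ ∑< n g
∑<-mono-≤ n f≤g = sum-mono-≤ (λ i → f≤g (toℕ i) (toℕ<n i))

∑<≡0⇒≡0 : ∀ n (f : ℕ → ℕ) → ∑< n f ≡ 0 → ∀ i → i < n → f i ≡ 0
∑<≡0⇒≡0 n f eq i i<n =
  subst (λ k → f k ≡ 0) (toℕ-fromℕ< i<n) (sum≡0⇒≡0 (f ∘ toℕ) eq (fromℕ< i<n))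

∑<-zero : ∀ n → ∑< n (λ _ → 0) ≡ 0
∑<-zero n = sum-replicate-zero n

∑<-one : ∀ n → ∑< n (λ _ → 1) ≡ n
∑<-one zero    = refl
∑<-one (suc n) = cong suc (∑<-one n)

∑<-distrib-+ : ∀ n (f g : ℕ → ℕ) → ∑< n (λ i → f i + g i) ≡ ∑< n f + ∑< n g
∑<-distrib-+ n f g = ∑-distrib-+ {n} (f ∘ toℕ) (g ∘ toℕ)

∑<-+ : ∀ a b (f : ℕ → ℕ) → ∑< (a + b) f ≡ ∑< a f + ∑< b (λ i → f (a + i))
∑<-+ zero    b f = refl
∑<-+ (suc a) b f = trans (cong (f 0 +_) (∑<-+ a b (f ∘ suc))) (sym (+-assoc (f 0) _ _))

∑<-suc : ∀ n (f : ℕ → ℕ) → ∑< (suc n) f ≡ ∑< n f + f n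
∑<-suc zero    f = +-identityʳ (f 0)
∑<-suc (suc n) f = trans (cong (f 0 +_) (∑<-suc n (f ∘ suc))) (sym (+-assoc (f 0) _ _))

∑<-comm : ∀ n {N} (g : Fin N → ℕ → ℕ) → ∑< n (λ r → sum (λ i → g i r)) ≡ sum (λ i → ∑< n (g i))
∑<-comm n g = ∑-comm {n} (λ r i → g i (toℕ r))

∑<-mono-bound : ∀ {m n} (f : ℕ → ℕ) → m ≤ n → ∑< m f ≤ ∑< n f
∑<-mono-bound f z≤n       = z≤n
∑<-mono-bound f (s≤s m≤n) = +-monoʳ-≤ (f 0) (∑<-mono-bound (f ∘ suc) m≤n)

∑<-split : ∀ {p L} (f : ℕ → ℕ) → p ≤ L → ∑< L f ≡ ∑< p f + ∑< (L ∸ p) (λ i → f (p + i))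
∑<-split {p} {L} f p≤L = trans (cong (λ n → ∑< n f) (sym (m+[n∸m]≡n p≤L))) (∑<-+ p (L ∸ p) f)

∑<-telescope : ∀ {g : ℕ → ℕ} → (∀ r → g (suc r) ≤ g r) →
               ∀ k → ∑< k (λ r → g r ∸ g (suc r)) + g k ≡ g 0
∑<-telescope         dec zero    = refl
∑<-telescope {g} dec (suc k) = begin
  (g 0 ∸ g 1) + ∑< k (λ r → g (suc r) ∸ g (suc (suc r))) + g (suc k)
    ≡⟨ +-assoc (g 0 ∸ g 1) _ _ ⟩
  (g 0 ∸ g 1) + (∑< k (λ r → g (suc r) ∸ g (suc (suc r))) + g (suc k))
    ≡⟨ cong ((g 0 ∸ g 1) +_) (∑<-telescope (dec ∘ suc) k) ⟩
  (g 0 ∸ g 1) + g 1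
    ≡⟨ m∸n+n≡m (dec 0) ⟩
  g 0 ∎
  where open ≡-Reasoning

-- Tableaux and horizontal strips

𝟙 : ∀ {p} {P : Set p} → Dec P → ℕ
𝟙 (yes _) = 1
𝟙 (no _)  = 0

𝟙-yes : ∀ {p} {P : Set p} (d : Dec P) → P → 𝟙 d ≡ 1
𝟙-yes (yes _) _ = refl
𝟙-yes (no ¬p) p = ⊥-elim (¬p p)

𝟙-no : ∀ {p} {P : Set p} (d : Dec P) → ¬ P → 𝟙 d ≡ 0
𝟙-no (yes p) ¬p = ⊥-elim (¬p p)
𝟙-no (no _)  _  = refl

𝟙≤1 : ∀ {p} {P : Set p} (d : Dec P) → 𝟙 d ≤ 1
𝟙≤1 (yes _) = ≤-refl
𝟙≤1 (no _)  = z≤n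

count : ℕ → (ℕ → ℕ) → ℕ → ℕ
count L e c = ∑< L (λ j → 𝟙 (e j ≟ c))

count-cong : ∀ L {e e′ : ℕ → ℕ} c → (∀ j → j < L → e j ≡ e′ j) → count L e c ≡ count L e′ c
count-cong L c e≡e′ = ∑<-cong L (λ j j<L → cong (λ x → 𝟙 (x ≟ c)) (e≡e′ j j<L))

countBelow : ℕ → (ℕ → ℕ) → ℕ → ℕ
countBelow L e t = ∑< L (λ j → 𝟙 (e j <? t))

countBelow≤ : ∀ L e t → countBelow L e t ≤ L
countBelow≤ L e t = ≤-trans (∑<-mono-≤ L (λ j _ → 𝟙≤1 (e j <? t))) (≤-reflexive (∑<-one L))

IncreasingOn : ℕ → (ℕ → ℕ) → Set
IncreasingOn L e = ∀ j → suc j < L → e j ≤ e (suc j)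

head≤ : ∀ {L e} → IncreasingOn L e → ∀ j → j < L → e 0 ≤ e j
head≤         inc zero    _   = ≤-refl
head≤ {suc L} inc (suc j) j<L =
  ≤-trans (inc 0 (≤-trans (s≤s (s≤s z≤n)) j<L)) (head≤ {L} (λ k k<L → inc (suc k) (s<s k<L)) j (s≤s⁻¹ j<L))

below-prefix : ∀ L {e} t → IncreasingOn L e → ∀ j → j < L → (j < countBelow L e t ⇔ e j < t)
below-prefix (suc L) {e} t inc j j<L with e 0 <? t
... | yes e0<t = shifted j j<L
  where
  shifted : ∀ j → j < suc L → (j < suc (countBelow L (e ∘ suc) t) ⇔ e j < t)
  shifted zero    _   = mk⇔ (λ _ → e0<t) (λ _ → z<s)
  shifted (suc j) j<L = mk⇔ (Equivalence.to ih ∘ s≤s⁻¹) (s<s ∘ Equivalence.from ih)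
    where ih = below-prefix L t (λ k k<L → inc (suc k) (s<s k<L)) j (s≤s⁻¹ j<L)
... | no e0≮t = mk⇔ (λ j<0 → ⊥-elim (n≮0 (subst (j <_) tail≡0 j<0))) (λ ej<t → ⊥-elim (≮t j j<L ej<t))
  where
  ≮t : ∀ k → k < suc L → ¬ e k < t
  ≮t k k<L ek<t = e0≮t (≤-<-trans (head≤ inc k k<L) ek<t)
  tail≡0 : countBelow L (e ∘ suc) t ≡ 0
  tail≡0 = trans (∑<-cong L (λ k k<L → 𝟙-no (e (suc k) <? t) (≮t (suc k) (s<s k<L)))) (∑<-zero L)


Decreasing : (ℕ → ℕ) → Set
Decreasing sh = ∀ r → sh (suc r) ≤ sh r

Vanishes : ℕ → (ℕ → ℕ) → Set
Vanishes R sh = ∀ r → R ≤ r → sh r ≡ 0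

-- A tableau of shape sh (row lengths) is a function E with entry E r j in row r, column j,
-- counted from 0; its values outside the cells j < sh r are irrelevant.
record IsSSYT (m : ℕ) (sh : ℕ → ℕ) (E : ℕ → ℕ → ℕ) : Set where
  field
    rows-increasing : ∀ r → IncreasingOn (sh r) (E r)
    columns-strict  : ∀ r j → j < sh (suc r) → E r j < E (suc r) j
    entries-<       : ∀ r j → j < sh r → E r j < m
open IsSSYT

empty-isSSYT : ∀ {m sh} E → (∀ r → sh r ≡ 0) → IsSSYT m sh E
empty-isSSYT {sh = sh} E sh≡0 = record
  { rows-increasing = λ r j p → ⊥-elim (outside r (suc j) p)
  ; columns-strict  = λ r j p → ⊥-elim (outside (suc r) j p)
  ; entries-<       = λ r j p → ⊥-elim (outside r j p)
  }
  where
  outside : ∀ r j → ¬ j < sh r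
  outside r j j<sh = n≮0 (subst (j <_) (sh≡0 r) j<sh)

isSSYT-0⇒empty : ∀ {sh E} → IsSSYT 0 sh E → ∀ r → sh r ≡ 0
isSSYT-0⇒empty T r = n≤0⇒n≡0 (≮⇒≥ (λ 0<sh → n≮0 (entries-< T r 0 0<sh)))

weight : ℕ → (ℕ → ℕ) → (ℕ → ℕ → ℕ) → ℕ → ℕ
weight R sh E c = ∑< R (λ r → count (sh r) (E r) c)


record HorizontalStrip (μ sh : ℕ → ℕ) : Set where
  field
    inner       : ∀ r → μ r ≤ sh r
    interlacing : ∀ r → sh (suc r) ≤ μ r
open HorizontalStrip

strip-decreasing : ∀ {μ sh} → HorizontalStrip μ sh → Decreasing μ
strip-decreasing s r = ≤-trans (inner s (suc r)) (interlacing s r)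

strip-tail : ∀ {μ sh} → HorizontalStrip μ sh → HorizontalStrip (μ ∘ suc) (sh ∘ suc)
strip-tail s = record { inner = inner s ∘ suc ; interlacing = interlacing s ∘ suc }

strip-size : ∀ {μ sh} → HorizontalStrip μ sh → ∀ n → ∑< n (λ r → sh r ∸ μ r) ≤ sh 0
strip-size         s zero    = z≤n
strip-size {μ} {sh} s (suc n) = begin
  (sh 0 ∸ μ 0) + ∑< n (λ r → sh (suc r) ∸ μ (suc r))
    ≤⟨ +-monoʳ-≤ (sh 0 ∸ μ 0) (strip-size (strip-tail s) n) ⟩
  (sh 0 ∸ μ 0) + sh 1
    ≤⟨ +-monoʳ-≤ (sh 0 ∸ μ 0) (interlacing s 0) ⟩
  (sh 0 ∸ μ 0) + μ 0
    ≡⟨ m∸n+n≡m (inner s 0) ⟩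
  sh 0 ∎
  where open ≤-Reasoning

-- The cells of a horizontal strip lie in distinct columns, so at most sh k of them are in rows r ≥ k.
strip-bound : ∀ {μ sh} → HorizontalStrip μ sh →
              ∀ k R → ∑< k μ + ∑< R (λ r → sh r ∸ μ r) ≤ ∑< (suc k) sh
strip-bound {μ} {sh} s zero R = begin
  ∑< R (λ r → sh r ∸ μ r) ≤⟨ strip-size s R ⟩
  sh 0                    ≡⟨ +-identityʳ (sh 0) ⟨
  sh 0 + 0                ∎
  where open ≤-Reasoning
strip-bound {μ} {sh} s (suc k) R = begin
  (μ 0 + ∑< k (μ ∘ suc)) + ∑< R D
    ≤⟨ +-monoʳ-≤ _ (∑<-≤-head R) ⟩
  (μ 0 + ∑< k (μ ∘ suc)) + (D 0 + ∑< R (D ∘ suc))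
    ≡⟨ +-interchange (μ 0) _ _ _ ⟩
  (μ 0 + D 0) + (∑< k (μ ∘ suc) + ∑< R (D ∘ suc))
    ≤⟨ +-mono-≤ (≤-reflexive (m+[n∸m]≡n (inner s 0))) (strip-bound (strip-tail s) k R) ⟩
  sh 0 + ∑< (suc k) (sh ∘ suc) ∎
  where
  open ≤-Reasoning
  D : ℕ → ℕ
  D r = sh r ∸ μ r
  ∑<-≤-head : ∀ R → ∑< R D ≤ D 0 + ∑< R (D ∘ suc)
  ∑<-≤-head zero    = z≤n
  ∑<-≤-head (suc R) = +-monoʳ-≤ (D 0) (∑<-mono-bound (D ∘ suc) (n≤1+n R))


padRow : ℕ → ℕ → (ℕ → ℕ) → ℕ → ℕ
padRow m p e j with j <? p
... | yes _ = e j
... | no  _ = m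

padRow-< : ∀ m {p} e {j} → j < p → padRow m p e j ≡ e j
padRow-< m {p} e {j} j<p with j <? p
... | yes _   = refl
... | no j≮p = ⊥-elim (j≮p j<p)

padRow-≥ : ∀ m {p} e {j} → p ≤ j → padRow m p e j ≡ m
padRow-≥ m {p} e {j} p≤j with j <? p
... | yes j<p = ⊥-elim (<-irrefl refl (<-≤-trans j<p p≤j))
... | no  _   = refl

count-padRow-≢ : ∀ {m p L} e c → p ≤ L → c ≢ m → count L (padRow m p e) c ≡ count p e c
count-padRow-≢ {m} {p} {L} e c p≤L c≢m = begin
  count L (padRow m p e) c
    ≡⟨ ∑<-split (λ j → 𝟙 (padRow m p e j ≟ c)) p≤L ⟩
  count p (padRow m p e) c + ∑< (L ∸ p) (λ i → 𝟙 (padRow m p e (p + i) ≟ c))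
    ≡⟨ cong₂ _+_ (count-cong p c (λ j → padRow-< m e)) (∑<-cong (L ∸ p) (λ i _ → not-c i)) ⟩
  count p e c + ∑< (L ∸ p) (λ _ → 0)
    ≡⟨ cong (count p e c +_) (∑<-zero (L ∸ p)) ⟩
  count p e c + 0
    ≡⟨ +-identityʳ _ ⟩
  count p e c ∎
  where
  open ≡-Reasoning
  not-c : ∀ i → 𝟙 (padRow m p e (p + i) ≟ c) ≡ 0
  not-c i = 𝟙-no (padRow m p e (p + i) ≟ c) (λ eq → c≢m (trans (sym eq) (padRow-≥ m e (m≤m+n p i))))

count-padRow-m : ∀ {m p L} e → p ≤ L → (∀ j → j < p → e j < m) → count L (padRow m p e) m ≡ L ∸ p
count-padRow-m {m} {p} {L} e p≤L e<m = begin
  count L (padRow m p e) m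
    ≡⟨ ∑<-split (λ j → 𝟙 (padRow m p e j ≟ m)) p≤L ⟩
  count p (padRow m p e) m + ∑< (L ∸ p) (λ i → 𝟙 (padRow m p e (p + i) ≟ m))
    ≡⟨ cong₂ _+_ (∑<-cong p low) (∑<-cong (L ∸ p) (λ i _ → high i)) ⟩
  ∑< p (λ _ → 0) + ∑< (L ∸ p) (λ _ → 1)
    ≡⟨ cong₂ _+_ (∑<-zero p) (∑<-one (L ∸ p)) ⟩
  L ∸ p ∎
  where
  open ≡-Reasoning
  low : ∀ j → j < p → 𝟙 (padRow m p e j ≟ m) ≡ 0
  low j j<p = 𝟙-no (padRow m p e j ≟ m) (λ eq → <⇒≢ (e<m j j<p) (trans (sym (padRow-< m e j<p)) eq))
  high : ∀ i → 𝟙 (padRow m p e (p + i) ≟ m) ≡ 1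
  high i = 𝟙-yes (padRow m p e (p + i) ≟ m) (padRow-≥ m e (m≤m+n p i))

extend : ℕ → (ℕ → ℕ) → (ℕ → ℕ → ℕ) → ℕ → ℕ → ℕ
extend m μ E r = padRow m (μ r) (E r)

module _ {m μ sh E} (s : HorizontalStrip μ sh) (T : IsSSYT m μ E) where

  extend-isSSYT : IsSSYT (suc m) sh (extend m μ E)
  extend-isSSYT = record
    { rows-increasing = rows
    ; columns-strict  = columns
    ; entries-<       = entries
    }
    where
    entries : ∀ r j → j < sh r → extend m μ E r j < suc m
    entries r j _ with j <? μ r
    ... | yes j<μ = m<n⇒m<1+n (entries-< T r j j<μ)
    ... | no  _   = n<1+n m
    rows : ∀ r → IncreasingOn (sh r) (extend m μ E r)
    rows r j _ with j <? μ r | suc j <? μ r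
    ... | yes _   | yes j+1<μ = rows-increasing T r j j+1<μ
    ... | yes j<μ | no  _     = <⇒≤ (entries-< T r j j<μ)
    ... | no  j≮μ | yes j+1<μ = ⊥-elim (j≮μ (<-trans (n<1+n j) j+1<μ))
    ... | no  _   | no  _     = ≤-refl
    columns : ∀ r j → j < sh (suc r) → extend m μ E r j < extend m μ E (suc r) j
    columns r j j<sh rewrite padRow-< m (E r) (<-≤-trans j<sh (interlacing s r)) with j <? μ (suc r)
    ... | yes j<μ = columns-strict T r j j<μ
    ... | no  _   = entries-< T r j (<-≤-trans j<sh (interlacing s r))

  weight-extend-< : ∀ R c → c < m → weight R sh (extend m μ E) c ≡ weight R μ E c
  weight-extend-< R c c<m = ∑<-cong R (λ r _ → count-padRow-≢ (E r) c (inner s r) (<⇒≢ c<m))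

  weight-extend-m : ∀ R → weight R sh (extend m μ E) m ≡ ∑< R (λ r → sh r ∸ μ r)
  weight-extend-m R = ∑<-cong R (λ r _ → count-padRow-m (E r) (inner s r) (entries-< T r))

-- Dominance

∑∈ : (ℕ → Bool) → ℕ → (ℕ → ℕ) → ℕ
∑∈ S m f = ∑< m (λ c → if S c then f c else 0)

card : (ℕ → Bool) → ℕ → ℕ
card S m = ∑∈ S m (λ _ → 1)

∑∈-suc : ∀ S m f → ∑∈ S (suc m) f ≡ ∑∈ S m f + (if S m then f m else 0)
∑∈-suc S m f = ∑<-suc m (λ c → if S c then f c else 0)

-- Comparing the sum over every set S of colours with the sum of the ∣S∣ largest parts
-- avoids sorting β: this is sort(β) ⊴ ν in the dominance order, with equal sizes.
record Dominated (m R : ℕ) (β ν : ℕ → ℕ) : Set where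
  field
    partial-≤ : ∀ S → ∑∈ S m β ≤ ∑< (card S m) ν
    total-≡   : ∑< m β ≡ ∑< R ν
open Dominated

module Restriction {m sh E} (dec : Decreasing sh) (T : IsSSYT (suc m) sh E) where

  μ : ℕ → ℕ
  μ r = countBelow (sh r) (E r) m

  private
    prefix : ∀ r j → j < sh r → (j < μ r ⇔ E r j < m)
    prefix r = below-prefix (sh r) m (rows-increasing T r)

  strip : HorizontalStrip μ sh
  strip = record
    { inner       = λ r → countBelow≤ (sh r) (E r) m
    ; interlacing = λ r → ≮⇒≥ (λ μ<sh → <-irrefl refl (Equivalence.from (prefix r (μ r) (<-≤-trans μ<sh (dec r)))
                      (<-≤-trans (columns-strict T r (μ r) μ<sh) (s≤s⁻¹ (entries-< T (suc r) (μ r) μ<sh)))))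
    }

  restriction : IsSSYT m μ E
  restriction = record
    { rows-increasing = λ r j j+1<μ → rows-increasing T r j (<-≤-trans j+1<μ (inner strip r))
    ; columns-strict  = λ r j j<μ → columns-strict T r j (<-≤-trans j<μ (inner strip (suc r)))
    ; entries-<       = λ r j j<μ → Equivalence.to (prefix r j (<-≤-trans j<μ (inner strip r))) j<μ
    }

  extend-restriction : ∀ r j → j < sh r → E r j ≡ extend m μ E r j
  extend-restriction r j j<sh with j <? μ r
  ... | yes _   = refl
  ... | no  j≮μ = ≤-antisym (s≤s⁻¹ (entries-< T r j j<sh)) (≮⇒≥ (j≮μ ∘ Equivalence.from (prefix r j j<sh)))

  weight≡weight-extend : ∀ R c → weight R sh E c ≡ weight R sh (extend m μ E) c
  weight≡weight-extend R c = ∑<-cong R (λ r _ → count-cong (sh r) c (extend-restriction r))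

  weight-restriction-< : ∀ R c → c < m → weight R sh E c ≡ weight R μ E c
  weight-restriction-< R c c<m = trans (weight≡weight-extend R c) (weight-extend-< strip restriction R c c<m)

  weight-restriction-m : ∀ R → weight R sh E m ≡ ∑< R (λ r → sh r ∸ μ r)
  weight-restriction-m R = trans (weight≡weight-extend R m) (weight-extend-m strip restriction R)

  total-restriction⇒total : ∀ R → ∑< m (weight R μ E) ≡ ∑< R μ → ∑< (suc m) (weight R sh E) ≡ ∑< R sh
  total-restriction⇒total R total-μ = begin
    ∑< (suc m) (weight R sh E)                  ≡⟨ ∑<-suc m (weight R sh E) ⟩
    ∑< m (weight R sh E) + weight R sh E m      ≡⟨ cong₂ _+_ (∑<-cong m (weight-restriction-< R))
                                                                  (weight-restriction-m R) ⟩
    ∑< m (weight R μ E) + ∑< R D                ≡⟨ cong (_+ ∑< R D) total-μ ⟩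
    ∑< R μ + ∑< R D                             ≡⟨ ∑<-distrib-+ R μ D ⟨
    ∑< R (λ r → μ r + D r)                      ≡⟨ ∑<-cong R (λ r _ → m+[n∸m]≡n (inner strip r)) ⟩
    ∑< R sh                                     ∎
    where
    open ≡-Reasoning
    D : ℕ → ℕ
    D r = sh r ∸ μ r

  partial-restriction⇒partial : ∀ R S → ∑∈ S m (weight R μ E) ≤ ∑< (card S m) μ →
                                ∑∈ S (suc m) (weight R sh E) ≤ ∑< (card S (suc m)) sh
  partial-restriction⇒partial R S partial-μ =
    subst₂ _≤_ (sym (∑∈-suc S m w)) (cong (λ k → ∑< k sh) (sym (∑∈-suc S m (λ _ → 1)))) (partial (S m))
    where
    w : ℕ → ℕ
    w = weight R sh E
    restrict : ∑∈ S m w ≡ ∑∈ S m (weight R μ E)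
    restrict = ∑<-cong m (λ c c<m → cong (λ x → if S c then x else 0) (weight-restriction-< R c c<m))
    partial : ∀ b → ∑∈ S m w + (if b then w m else 0) ≤ ∑< (card S m + (if b then 1 else 0)) sh
    partial false = begin
      ∑∈ S m w + 0                ≡⟨ +-identityʳ _ ⟩
      ∑∈ S m w                    ≡⟨ restrict ⟩
      ∑∈ S m (weight R μ E)       ≤⟨ partial-μ ⟩
      ∑< (card S m) μ             ≤⟨ ∑<-mono-≤ (card S m) (λ r _ → inner strip r) ⟩
      ∑< (card S m) sh            ≡⟨ cong (λ n → ∑< n sh) (+-identityʳ (card S m)) ⟨
      ∑< (card S m + 0) sh        ∎
      where open ≤-Reasoning
    partial true = begin
      ∑∈ S m w + w m                                ≡⟨ cong₂ _+_ restrict (weight-restriction-m R) ⟩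
      ∑∈ S m (weight R μ E) + ∑< R (λ r → sh r ∸ μ r) ≤⟨ +-monoˡ-≤ _ partial-μ ⟩
      ∑< (card S m) μ + ∑< R (λ r → sh r ∸ μ r)     ≤⟨ strip-bound strip (card S m) R ⟩
      ∑< (suc (card S m)) sh                        ≡⟨ cong (λ n → ∑< n sh) (+-comm 1 (card S m)) ⟩
      ∑< (card S m + 1) sh                          ∎
      where open ≤-Reasoning

isSSYT⇒dominated : ∀ m R {sh E} → Decreasing sh → IsSSYT m sh E → Dominated m R (weight R sh E) sh
isSSYT⇒dominated zero    R dec T = record
  { partial-≤ = λ _ → z≤n
  ; total-≡   = sym (trans (∑<-cong R (λ r _ → isSSYT-0⇒empty T r)) (∑<-zero R))
  }
isSSYT⇒dominated (suc m) R {sh} {E} dec T = record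
  { partial-≤ = λ S → partial-restriction⇒partial R S (partial-≤ ih S)
  ; total-≡   = total-restriction⇒total R (total-≡ ih)
  }
  where
  open Restriction dec T
  ih : Dominated m R (weight R μ E) μ
  ih = isSSYT⇒dominated m R (strip-decreasing strip) restriction

dominated-sum : ∀ {m R N} {β ν : Fin N → ℕ → ℕ} → (∀ i → Dominated m R (β i) (ν i)) →
                Dominated m R (λ c → sum (λ i → β i c)) (λ r → sum (λ i → ν i r))
dominated-sum {m} {R} {N} {β} {ν} dom = record
  { partial-≤ = partial
  ; total-≡   = trans (∑<-comm m β) (trans (sum-cong-≗ (λ i → total-≡ (dom i))) (sym (∑<-comm R ν)))
  }
  where
  if-sum : ∀ b c → (if b then sum (λ i → β i c) else 0) ≡ sum (λ i → if b then β i c else 0)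
  if-sum true  c = refl
  if-sum false c = sym (sum-replicate-zero N)
  partial : ∀ S → ∑∈ S m (λ c → sum (λ i → β i c)) ≤ ∑< (card S m) (λ r → sum (λ i → ν i r))
  partial S = begin
    ∑∈ S m (λ c → sum (λ i → β i c))                    ≡⟨ ∑<-cong m (λ c _ → if-sum (S c) c) ⟩
    ∑< m (λ c → sum (λ i → if S c then β i c else 0))  ≡⟨ ∑<-comm m (λ i c → if S c then β i c else 0) ⟩
    sum (λ i → ∑∈ S m (β i))                            ≤⟨ sum-mono-≤ (λ i → partial-≤ (dom i) S) ⟩
    sum (λ i → ∑< (card S m) (ν i))                     ≡⟨ ∑<-comm (card S m) ν ⟨
    ∑< (card S m) (λ r → sum (λ i → ν i r))             ∎
    where open ≤-Reasoning

-- Realising a dominated weight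

setColour : (ℕ → Bool) → ℕ → Bool → ℕ → Bool
setColour S m b c with c ≟ m
... | yes _ = b
... | no  _ = S c

∑∈-setColour : ∀ S m b f → ∑∈ (setColour S m b) (suc m) f ≡ ∑∈ S m f + (if b then f m else 0)
∑∈-setColour S m b f = trans (∑∈-suc (setColour S m b) m f) (cong₂ _+_ (∑<-cong m below) at-m)
  where
  below : ∀ c → c < m → (if setColour S m b c then f c else 0) ≡ (if S c then f c else 0)
  below c c<m with c ≟ m
  ... | yes c≡m = ⊥-elim (<⇒≢ c<m c≡m)
  ... | no  _   = refl
  at-m : (if setColour S m b m then f m else 0) ≡ (if b then f m else 0)
  at-m with m ≟ m
  ... | yes _   = refl
  ... | no  m≢m = ⊥-elim (m≢m refl)

∑<-peel : ∀ {a} {ν ν′ ρ : ℕ → ℕ} → (∀ r → ν′ r + ρ r ≡ ν r) → (∀ k → ∑< k ρ + a ⊓ ν k ≡ a) →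
          ∀ k → ∑< k ν′ + a ≡ ∑< k ν + a ⊓ ν k
∑<-peel {a} {ν} {ν′} {ρ} split profile k = begin
  ∑< k ν′ + a                        ≡⟨ cong (∑< k ν′ +_) (profile k) ⟨
  ∑< k ν′ + (∑< k ρ + a ⊓ ν k)       ≡⟨ +-assoc (∑< k ν′) _ _ ⟨
  ∑< k ν′ + ∑< k ρ + a ⊓ ν k         ≡⟨ cong (_+ a ⊓ ν k) (∑<-distrib-+ k ν′ ρ) ⟨
  ∑< k (λ r → ν′ r + ρ r) + a ⊓ ν k  ≡⟨ cong (_+ a ⊓ ν k) (∑<-cong k (λ r _ → split r)) ⟩
  ∑< k ν + a ⊓ ν k                   ∎
  where open ≡-Reasoning

module _ {m R β ν} (dom : Dominated (suc m) R β ν) where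

  partial-setColour : ∀ S b → ∑∈ S m β + (if b then β m else 0) ≤ ∑< (card S m + (if b then 1 else 0)) ν
  partial-setColour S b = subst₂ _≤_ (∑∈-setColour S m b β)
                            (cong (λ k → ∑< k ν) (∑∈-setColour S m b (λ _ → 1))) (partial-≤ dom (setColour S m b))

  dominated-≤-first-part : β m ≤ ν 0
  dominated-≤-first-part =
    subst₂ _≤_ (cong (_+ β m) (∑<-zero m))
      (trans (cong (λ k → ∑< k ν) (cong (_+ 1) (∑<-zero m))) (+-identityʳ (ν 0)))
      (partial-setColour (λ _ → false) true)

  dominated-peel : ∀ {ν′} (ρ : ℕ → ℕ) → (∀ r → ν′ r + ρ r ≡ ν r) →
                   (∀ k → ∑< k ρ + β m ⊓ ν k ≡ β m) → ∑< R ρ ≡ β m → Dominated m R β ν′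
  dominated-peel {ν′} ρ split profile ∑ρ≡a = record { partial-≤ = partial ; total-≡ = total }
    where
    a : ℕ
    a = β m
    key : ∀ k → ∑< k ν′ + a ≡ ∑< k ν + a ⊓ ν k
    key = ∑<-peel {ν = ν} {ν′} {ρ} split profile
    total : ∑< m β ≡ ∑< R ν′
    total = +-cancelʳ-≡ a _ _ (begin
      ∑< m β + a                ≡⟨ ∑<-suc m β ⟨
      ∑< (suc m) β              ≡⟨ total-≡ dom ⟩
      ∑< R ν                    ≡⟨ ∑<-cong R (λ r _ → split r) ⟨
      ∑< R (λ r → ν′ r + ρ r)   ≡⟨ ∑<-distrib-+ R ν′ ρ ⟩
      ∑< R ν′ + ∑< R ρ          ≡⟨ cong (∑< R ν′ +_) ∑ρ≡a ⟩
      ∑< R ν′ + a               ∎)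
      where open ≡-Reasoning
    partial : ∀ S → ∑∈ S m β ≤ ∑< (card S m) ν′
    partial S with a ≤? ν (card S m)
    ... | yes a≤ν = begin
      ∑∈ S m β                  ≡⟨ +-identityʳ _ ⟨
      ∑∈ S m β + 0              ≤⟨ partial-setColour S false ⟩
      ∑< (card S m + 0) ν       ≡⟨ cong (λ k → ∑< k ν) (+-identityʳ (card S m)) ⟩
      ∑< (card S m) ν           ≡⟨ +-cancelʳ-≡ a _ _ (trans (key (card S m)) (cong (_ +_) (m≤n⇒m⊓n≡m a≤ν))) ⟨
      ∑< (card S m) ν′          ∎
      where open ≤-Reasoning
    ... | no a≰ν = +-cancelʳ-≤ a _ _ (begin
      ∑∈ S m β + a                       ≤⟨ partial-setColour S true ⟩
      ∑< (card S m + 1) ν                ≡⟨ cong (λ k → ∑< k ν) (+-comm (card S m) 1) ⟩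
      ∑< (suc (card S m)) ν              ≡⟨ ∑<-suc (card S m) ν ⟩
      ∑< (card S m) ν + ν (card S m)     ≡⟨ cong (_ +_) (m≥n⇒m⊓n≡n (<⇒≤ (≰⇒> a≰ν))) ⟨
      ∑< (card S m) ν + a ⊓ ν (card S m) ≡⟨ key (card S m) ⟨
      ∑< (card S m) ν′ + a               ∎)
      where open ≤-Reasoning

-- Row r's share when a copies of the largest letter are pushed as low as possible into the
-- shape ν, at most ν r ∸ ν (suc r) per row: the rows r ≥ k then receive a ⊓ ν k of them.
stripProfile : ℕ → (ℕ → ℕ) → ℕ → ℕ
stripProfile a ν r = a ⊓ ν r ∸ a ⊓ ν (suc r)

stripProfile-fits : ∀ a {ν} → Decreasing ν → ∀ r → stripProfile a ν r + ν (suc r) ≤ ν r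
stripProfile-fits a {ν} dec r with a ≤? ν (suc r)
... | yes a≤ν rewrite m≤n⇒m⊓n≡m a≤ν | m≤n⇒m⊓n≡m (≤-trans a≤ν (dec r)) | n∸n≡0 a = dec r
... | no  a≰ν rewrite m≥n⇒m⊓n≡n (<⇒≤ (≰⇒> a≰ν)) =
  subst (_≤ ν r) (sym (m∸n+n≡m (⊓-glb (<⇒≤ (≰⇒> a≰ν)) (dec r)))) (m⊓n≤n a (ν r))

stripProfile-sum : ∀ {a ν} → Decreasing ν → a ≤ ν 0 → ∀ k → ∑< k (stripProfile a ν) + a ⊓ ν k ≡ a
stripProfile-sum {a} dec a≤ν0 k = trans (∑<-telescope (λ r → ⊓-monoʳ-≤ a (dec r)) k) (m≤n⇒m⊓n≡m a≤ν0)

decompose-≤-sum : ∀ {N} (d : Fin N → ℕ) {x} → x ≤ sum d →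
                  Σ (Fin N → ℕ) λ σ → (∀ i → σ i ≤ d i) × sum σ ≡ x
decompose-≤-sum {zero}  d x≤0 = (λ ()) , (λ ()) , sym (n≤0⇒n≡0 x≤0)
decompose-≤-sum {suc N} d {x} x≤d with decompose-≤-sum (d ∘ fsuc) {x ∸ d fzero} (m≤n+o⇒m∸n≤o x (d fzero) x≤d)
... | σ , σ≤d , σ-sum = σ′ , σ′≤d , trans (cong (d fzero ⊓ x +_) σ-sum) (m⊓n+n∸m≡n (d fzero) x)
  where
  σ′ : Fin (suc N) → ℕ
  σ′ fzero    = d fzero ⊓ x
  σ′ (fsuc i) = σ i
  σ′≤d : ∀ i → σ′ i ≤ d i
  σ′≤d fzero    = m⊓n≤m (d fzero) x
  σ′≤d (fsuc i) = σ≤d i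

record Strips {N} (shapes : Fin N → ℕ → ℕ) (ρ : ℕ → ℕ) : Set where
  field
    inner-shape : Fin N → ℕ → ℕ
    isStrip     : ∀ i → HorizontalStrip (inner-shape i) (shapes i)
    strip-rows  : ∀ r → sum (λ i → shapes i r ∸ inner-shape i r) ≡ ρ r

fits⇒strips : ∀ {N} {shapes : Fin N → ℕ → ℕ} {ρ : ℕ → ℕ} → (∀ i → Decreasing (shapes i)) →
           (∀ r → ρ r + sum (λ i → shapes i (suc r)) ≤ sum (λ i → shapes i r)) → Strips shapes ρ
fits⇒strips {N} {shapes} {ρ} dec fits = record { inner-shape = μ ; isStrip = strip ; strip-rows = strip-sum }
  where
  d : ℕ → Fin N → ℕ
  d r i = shapes i r ∸ shapes i (suc r)
  ρ≤d : ∀ r → ρ r ≤ sum (d r)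
  ρ≤d r = +-cancelʳ-≤ (sum (λ i → shapes i (suc r))) _ _ (≤-trans (fits r) (≤-reflexive (begin
    sum (λ i → shapes i r)                                   ≡⟨ sum-cong-≗ (λ i → m∸n+n≡m (dec i r)) ⟨
    sum (λ i → d r i + shapes i (suc r))                     ≡⟨ ∑-distrib-+ (d r) (λ i → shapes i (suc r)) ⟩
    sum (d r) + sum (λ i → shapes i (suc r))                 ∎)))
    where open ≡-Reasoning
  σ : Fin N → ℕ → ℕ
  σ i r = proj₁ (decompose-≤-sum (d r) (ρ≤d r)) i
  σ≤d : ∀ i r → σ i r ≤ d r i
  σ≤d i r = proj₁ (proj₂ (decompose-≤-sum (d r) (ρ≤d r))) i
  μ : Fin N → ℕ → ℕ
  μ i r = shapes i r ∸ σ i r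
  strip : ∀ i → HorizontalStrip (μ i) (shapes i)
  strip i = record
    { inner       = λ r → m∸n≤m (shapes i r) (σ i r)
    ; interlacing = λ r → m+n≤o⇒m≤o∸n (shapes i (suc r)) (begin
        shapes i (suc r) + σ i r   ≤⟨ +-monoʳ-≤ (shapes i (suc r)) (σ≤d i r) ⟩
        shapes i (suc r) + d r i   ≡⟨ m+[n∸m]≡n (dec i r) ⟩
        shapes i r                 ∎)
    }
    where open ≤-Reasoning
  σ≤shape : ∀ i r → σ i r ≤ shapes i r
  σ≤shape i r = ≤-trans (σ≤d i r) (m∸n≤m (shapes i r) (shapes i (suc r)))
  strip-sum : ∀ r → sum (λ i → shapes i r ∸ μ i r) ≡ ρ r
  strip-sum r = trans (sum-cong-≗ (λ i → m∸[m∸n]≡n (σ≤shape i r))) (proj₂ (proj₂ (decompose-≤-sum (d r) (ρ≤d r))))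

peel-shapes : ∀ {m R N} {shapes : Fin N → ℕ → ℕ} {β} →
  (∀ i → Decreasing (shapes i)) → (∀ i → Vanishes R (shapes i)) →
  Dominated (suc m) R β (λ r → sum (λ i → shapes i r)) →
  Σ (Fin N → ℕ → ℕ) λ μ → (∀ i → HorizontalStrip (μ i) (shapes i)) ×
    Dominated m R β (λ r → sum (λ i → μ i r)) ×
    (∑< R (λ r → sum (λ i → shapes i r ∸ μ i r)) ≡ β m)
peel-shapes {m} {R} {N} {shapes} {β} dec vanish dom =
  μ , strip , dominated-peel dom ρ split profile ∑ρ≡a , total
  where
  ν : ℕ → ℕ
  ν r = sum (λ i → shapes i r)
  ν-dec : Decreasing ν
  ν-dec r = sum-mono-≤ (λ i → dec i r)
  ρ : ℕ → ℕ
  ρ = stripProfile (β m) ν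
  open Strips (fits⇒strips dec (stripProfile-fits (β m) ν-dec))
    renaming (inner-shape to μ; isStrip to strip; strip-rows to strip-sum)
  profile : ∀ k → ∑< k ρ + β m ⊓ ν k ≡ β m
  profile = stripProfile-sum ν-dec (dominated-≤-first-part dom)
  νR≡0 : ν R ≡ 0
  νR≡0 = trans (sum-cong-≗ (λ i → vanish i R ≤-refl)) (sum-replicate-zero N)
  split : ∀ r → sum (λ i → μ i r) + ρ r ≡ ν r
  split r = begin
    sum (λ i → μ i r) + ρ r                              ≡⟨ cong (sum (λ i → μ i r) +_) (strip-sum r) ⟨
    sum (λ i → μ i r) + sum (λ i → shapes i r ∸ μ i r)   ≡⟨ ∑-distrib-+ (λ i → μ i r) _ ⟨
    sum (λ i → μ i r + (shapes i r ∸ μ i r))             ≡⟨ sum-cong-≗ (λ i → m+[n∸m]≡n (inner (strip i) r)) ⟩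
    ν r                                                  ∎
    where open ≡-Reasoning
  ∑ρ≡a : ∑< R ρ ≡ β m
  ∑ρ≡a = begin
    ∑< R ρ              ≡⟨ +-identityʳ (∑< R ρ) ⟨
    ∑< R ρ + 0          ≡⟨ cong (∑< R ρ +_) (trans (cong (β m ⊓_) νR≡0) (⊓-zeroʳ (β m))) ⟨
    ∑< R ρ + β m ⊓ ν R  ≡⟨ profile R ⟩
    β m                 ∎
    where open ≡-Reasoning
  total : ∑< R (λ r → sum (λ i → shapes i r ∸ μ i r)) ≡ β m
  total = trans (∑<-cong R (λ r _ → strip-sum r)) ∑ρ≡a

record TableauxOfWeight (m R : ℕ) {N} (shapes : Fin N → ℕ → ℕ) (β : ℕ → ℕ) : Set where
  field
    filling        : Fin N → ℕ → ℕ → ℕ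
    filling-isSSYT : ∀ i → IsSSYT m (shapes i) (filling i)
    weight-filling : ∀ c → c < m → sum (λ i → weight R (shapes i) (filling i) c) ≡ β c
open TableauxOfWeight

dominated⇒tableaux : ∀ m {R N} {shapes : Fin N → ℕ → ℕ} {β} →
  (∀ i → Decreasing (shapes i)) → (∀ i → Vanishes R (shapes i)) →
  Dominated m R β (λ r → sum (λ i → shapes i r)) → TableauxOfWeight m R shapes β
dominated⇒tableaux zero {R} {N} {shapes} dec vanish dom = record
  { filling        = λ _ _ _ → 0
  ; filling-isSSYT = λ i → empty-isSSYT _ (empty i)
  ; weight-filling = λ _ ()
  }
  where
  empty : ∀ i r → shapes i r ≡ 0
  empty i r with r <? R
  ... | yes r<R = sum≡0⇒≡0 (λ i → shapes i r) (∑<≡0⇒≡0 R _ (sym (total-≡ dom)) r r<R) i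
  ... | no  r≮R = vanish i r (≮⇒≥ r≮R)
dominated⇒tableaux (suc m) {R} {N} {shapes} {β} dec vanish dom
  with peel-shapes dec vanish dom
... | μ , strip , dom-μ , m-count = record
  { filling        = λ i → extend m (μ i) (filling T i)
  ; filling-isSSYT = λ i → extend-isSSYT (strip i) (filling-isSSYT T i)
  ; weight-filling = weights
  }
  where
  T : TableauxOfWeight m R μ β
  T = dominated⇒tableaux m (λ i → strip-decreasing (strip i))
        (λ i r R≤r → n≤0⇒n≡0 (subst (μ i r ≤_) (vanish i r R≤r) (inner (strip i) r))) dom-μ
  weights : ∀ c → c < suc m → sum (λ i → weight R (shapes i) (extend m (μ i) (filling T i)) c) ≡ β c
  weights c c<1+m with m≤n⇒m<n∨m≡n (s≤s⁻¹ c<1+m)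
  ... | inj₁ c<m  = trans (sum-cong-≗ (λ i → weight-extend-< (strip i) (filling-isSSYT T i) R c c<m))
                          (weight-filling T c c<m)
  ... | inj₂ refl = trans (sum-cong-≗ (λ i → weight-extend-m (strip i) (filling-isSSYT T i) R))
                          (trans (sym (∑<-comm R (λ i r → shapes i r ∸ μ i r))) m-count)

-- Fillings of partitions

shape : Partition → ℕ → ℕ
shape lam = part (parts lam)

part-decreasing : ∀ {rs} → Linked (λ a b → b ≤ a) rs → Decreasing (part rs)
part-decreasing []           _       = z≤n
part-decreasing [-]          _       = z≤n
part-decreasing (b≤a ∷ _)    zero    = b≤a
part-decreasing (_ ∷ linked) (suc r) = part-decreasing linked r

part-vanishes : ∀ rs {R} → length rs ≤ R → Vanishes R (part rs)
part-vanishes []       _         _       _       = refl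
part-vanishes (_ ∷ rs) (s≤s len) (suc r) (s≤s R≤r) = part-vanishes rs len r R≤r

lookupRow-< : ∀ {m r} (row : Vec (Fin m) r) j → j < r → lookupRow row j < m
lookupRow-< (x ∷ _)  zero    _   = toℕ<n x
lookupRow-< (_ ∷ xs) (suc j) j<r = lookupRow-< xs j (s≤s⁻¹ j<r)

entry-< : ∀ {m} rs (T : Filling m rs) r j → j < part rs r → entry rs T r j < m
entry-< (_ ∷ _)  (row , _) zero    j j<r = lookupRow-< row j j<r
entry-< (_ ∷ rs) (_ , T)   (suc r) j j<r = entry-< rs T r j j<r

ssyt⇒isSSYT : ∀ {m} lam (T : SSYT m lam) → IsSSYT m (shape lam) (entry (parts lam) (proj₁ T))
ssyt⇒isSSYT lam (T , rows , columns) = record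
  { rows-increasing = rows
  ; columns-strict  = columns
  ; entries-<       = entry-< (parts lam) T
  }

countRow≡count : ∀ {m r} (k : Fin m) (row : Vec (Fin m) r) → countRow k row ≡ count r (lookupRow row) (toℕ k)
countRow≡count k []       = refl
countRow≡count k (x ∷ xs) with k F.≟ x
... | yes refl = cong₂ _+_ (sym (𝟙-yes (toℕ k ≟ toℕ k) refl)) (countRow≡count k xs)
... | no  k≢x  = cong₂ _+_ (sym (𝟙-no (toℕ x ≟ toℕ k) (k≢x ∘ sym ∘ toℕ-injective))) (countRow≡count k xs)

lookup-contentF : ∀ {m} rs (T : Filling m rs) {R} → length rs ≤ R →
                  ∀ k → lookup (contentF rs T) k ≡ weight R (part rs) (entry rs T) (toℕ k)
lookup-contentF []       _       {R} _         k = trans (lookup-replicate k 0) (sym (∑<-zero R))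
lookup-contentF (r ∷ rs) (row , T) {suc R} (s≤s len≤R) k = begin
  lookup (zipWith _+_ (tabulate (λ k → countRow k row)) (contentF rs T)) k
    ≡⟨ lookup-zipWith _+_ k (tabulate (λ k → countRow k row)) (contentF rs T) ⟩
  lookup (tabulate (λ k → countRow k row)) k + lookup (contentF rs T) k
    ≡⟨ cong₂ _+_ (trans (lookup∘tabulate _ k) (countRow≡count k row)) (lookup-contentF rs T len≤R k) ⟩
  count r (lookupRow row) (toℕ k) + weight R (part rs) (entry rs T) (toℕ k) ∎
  where open ≡-Reasoning

tabulateRow : ∀ {m} n (f : ℕ → ℕ) → (∀ j → j < n → f j < m) → Vec (Fin m) n
tabulateRow zero    f _   = []
tabulateRow (suc n) f f<m = fromℕ< (f<m 0 z<s) ∷ tabulateRow n (f ∘ suc) (λ j j<n → f<m (suc j) (s<s j<n))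

lookupRow-tabulateRow : ∀ {m} n f (f<m : ∀ j → j < n → f j < m) j → j < n → lookupRow (tabulateRow n f f<m) j ≡ f j
lookupRow-tabulateRow (suc n) f f<m zero    _   = toℕ-fromℕ< (f<m 0 z<s)
lookupRow-tabulateRow (suc n) f f<m (suc j) j<n = lookupRow-tabulateRow n (f ∘ suc) _ j (s≤s⁻¹ j<n)

tabulateFilling : ∀ {m} rs (E : ℕ → ℕ → ℕ) → (∀ r j → j < part rs r → E r j < m) → Filling m rs
tabulateFilling []       E _   = tt
tabulateFilling (r ∷ rs) E E<m = tabulateRow r (E 0) (E<m 0) , tabulateFilling rs (E ∘ suc) (E<m ∘ suc)

entry-tabulateFilling : ∀ {m} rs E (E<m : ∀ r j → j < part rs r → E r j < m) r j → j < part rs r →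
                        entry rs (tabulateFilling rs E E<m) r j ≡ E r j
entry-tabulateFilling (r ∷ rs) E E<m zero    j j<r = lookupRow-tabulateRow r (E 0) (E<m 0) j j<r
entry-tabulateFilling (_ ∷ rs) E E<m (suc r) j j<r = entry-tabulateFilling rs (E ∘ suc) (E<m ∘ suc) r j j<r

module _ {m} (lam : Partition) {E} (T : IsSSYT m (shape lam) E) where

  private
    F : Filling m (parts lam)
    F = tabulateFilling (parts lam) E (entries-< T)
    entry≡E : ∀ r j → j < shape lam r → entry (parts lam) F r j ≡ E r j
    entry≡E = entry-tabulateFilling (parts lam) E (entries-< T)

  tabulateSSYT : SSYT m lam
  tabulateSSYT = F , rows , columns
    where
    rows : ∀ r j → suc j < shape lam r → entry (parts lam) F r j ≤ entry (parts lam) F r (suc j)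
    rows r j j+1<sh = subst₂ _≤_ (sym (entry≡E r j (<-trans (n<1+n j) j+1<sh))) (sym (entry≡E r (suc j) j+1<sh))
                        (rows-increasing T r j j+1<sh)
    columns : ∀ r j → j < shape lam (suc r) → entry (parts lam) F r j < entry (parts lam) F (suc r) j
    columns r j j<sh = subst₂ _<_ (sym (entry≡E r j (<-≤-trans j<sh (part-decreasing (decr lam) r))))
                         (sym (entry≡E (suc r) j j<sh)) (columns-strict T r j j<sh)

  content-tabulateSSYT : ∀ {R} → length (parts lam) ≤ R →
                         ∀ k → lookup (content lam tabulateSSYT) k ≡ weight R (shape lam) E (toℕ k)
  content-tabulateSSYT {R} len≤R k = trans (lookup-contentF (parts lam) _ len≤R k)
    (∑<-cong R (λ r _ → count-cong (shape lam r) (toℕ k) (entry≡E r)))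

lookup-sumVecs : ∀ {m} N (v : Fin N → Vec ℕ m) k → lookup (sumVecs N v) k ≡ sum (λ i → lookup (v i) k)
lookup-sumVecs zero    v k = lookup-replicate k 0
lookup-sumVecs (suc N) v k = trans (lookup-zipWith _+_ k (v fzero) (sumVecs N (v ∘ fsuc)))
                                   (cong (lookup (v fzero) k +_) (lookup-sumVecs N (v ∘ fsuc) k))

lookup₀ : ∀ {m} → Vec ℕ m → ℕ → ℕ
lookup₀ []       _       = 0
lookup₀ (x ∷ _)  zero    = x
lookup₀ (_ ∷ xs) (suc c) = lookup₀ xs c

lookup₀-toℕ : ∀ {m} (v : Vec ℕ m) k → lookup₀ v (toℕ k) ≡ lookup v k
lookup₀-toℕ (_ ∷ _)  fzero    = refl
lookup₀-toℕ (_ ∷ xs) (fsuc k) = lookup₀-toℕ xs k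

lookup-extensionality : ∀ {a} {A : Set a} {m} (u v : Vec A m) → (∀ k → lookup u k ≡ lookup v k) → u ≡ v
lookup-extensionality u v u≗v = trans (sym (tabulate∘lookup u)) (trans (tabulate-cong u≗v) (tabulate∘lookup v))

dominated-cong : ∀ {m R β β′ ν} → (∀ c → c < m → β c ≡ β′ c) → Dominated m R β ν → Dominated m R β′ ν
dominated-cong {m} β≡β′ dom = record
  { partial-≤ = λ S → subst (_≤ _) (∑<-cong m (λ c c<m → cong (λ x → if S c then x else 0) (β≡β′ c c<m)))
                        (partial-≤ dom S)
  ; total-≡   = trans (sym (∑<-cong m β≡β′)) (total-≡ dom)
  }

module Product {N} (lams : Fin N → Partition) where

  R : ℕ
  R = sum (λ i → length (parts (lams i)))

  length≤R : ∀ i → length (parts (lams i)) ≤ R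
  length≤R = ≤-sum (λ i → length (parts (lams i)))

  ν : ℕ → ℕ
  ν r = sum (λ i → shape (lams i) r)

  support-dominated : ∀ {m} v → InSupport (productExp m N lams) v →
                      Σ (Vec ℕ m) λ e → v ≡ map pos e × Dominated m R (lookup₀ e) ν
  support-dominated {m} _ (T , refl) = productExp m N lams T , refl , dominated-cong exp≡ dom
    where
    E : Fin N → ℕ → ℕ → ℕ
    E i = entry (parts (lams i)) (proj₁ (T i))
    dom : Dominated m R (λ c → sum (λ i → weight R (shape (lams i)) (E i) c)) ν
    dom = dominated-sum (λ i → isSSYT⇒dominated m R (part-decreasing (decr (lams i))) (ssyt⇒isSSYT (lams i) (T i)))
    exp≡ : ∀ c → c < m → sum (λ i → weight R (shape (lams i)) (E i) c) ≡ lookup₀ (productExp m N lams T) c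
    exp≡ c c<m = begin
      sum (λ i → weight R (shape (lams i)) (E i) c)
        ≡⟨ cong (λ x → sum (λ i → weight R (shape (lams i)) (E i) x)) (toℕ-fromℕ< c<m) ⟨
      sum (λ i → weight R (shape (lams i)) (E i) (toℕ (fromℕ< c<m)))
        ≡⟨ sum-cong-≗ (λ i → lookup-contentF (parts (lams i)) (proj₁ (T i)) (length≤R i) (fromℕ< c<m)) ⟨
      sum (λ i → lookup (content (lams i) (T i)) (fromℕ< c<m))
        ≡⟨ lookup-sumVecs N (λ i → content (lams i) (T i)) (fromℕ< c<m) ⟨
      lookup (productExp m N lams T) (fromℕ< c<m)
        ≡⟨ lookup₀-toℕ (productExp m N lams T) (fromℕ< c<m) ⟨
      lookup₀ (productExp m N lams T) (toℕ (fromℕ< c<m))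
        ≡⟨ cong (lookup₀ (productExp m N lams T)) (toℕ-fromℕ< c<m) ⟩
      lookup₀ (productExp m N lams T) c ∎
      where open ≡-Reasoning

  dominated-inSupport : ∀ {m} (e : Vec ℕ m) → Dominated m R (lookup₀ e) ν → InSupport (productExp m N lams) (map pos e)
  dominated-inSupport {m} e dom = T , cong (map pos) (lookup-extensionality _ e exp≡)
    where
    tableaux : TableauxOfWeight m R (λ i → shape (lams i)) (lookup₀ e)
    tableaux = dominated⇒tableaux m (λ i → part-decreasing (decr (lams i)))
                 (λ i → part-vanishes (parts (lams i)) (length≤R i)) dom
    T : ProductTerm m N lams
    T i = tabulateSSYT (lams i) (filling-isSSYT tableaux i)
    exp≡ : ∀ k → lookup (productExp m N lams T) k ≡ lookup e k
    exp≡ k = begin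
      lookup (productExp m N lams T) k
        ≡⟨ lookup-sumVecs N (λ i → content (lams i) (T i)) k ⟩
      sum (λ i → lookup (content (lams i) (T i)) k)
        ≡⟨ sum-cong-≗ (λ i → content-tabulateSSYT (lams i) (filling-isSSYT tableaux i) (length≤R i) k) ⟩
      sum (λ i → weight R (shape (lams i)) (filling tableaux i) (toℕ k))
        ≡⟨ weight-filling tableaux (toℕ k) (toℕ<n k) ⟩
      lookup₀ e (toℕ k)
        ≡⟨ lookup₀-toℕ e k ⟩
      lookup e k ∎
      where open ≡-Reasoning

-- Rational convex hulls

module ℚ∑ = Algebra.Properties.Semiring.Sum (CommutativeRing.semiring ℚP.+-*-commutativeRing)

ι : ℤ → ℚ
ι i = i ℚ./ 1

-- i / 1 is already in normal form, so ℚ-arithmetic on such fractions computes as on ℤ.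
ι≡mkℚ : ∀ i → ι i ≡ mkℚ i 0 (Coprimality.sym (1-coprimeTo _))
ι≡mkℚ (pos n)    = ℚP.normalize-coprime (Coprimality.sym (1-coprimeTo n))
ι≡mkℚ ℤ.-[1+ n ] = cong ℚ.-_ (ℚP.normalize-coprime (Coprimality.sym (1-coprimeTo (suc n))))

ι-+ : ∀ i j → ι (i ℤ.+ j) ≡ ι i ℚ.+ ι j
ι-+ i j = begin
  ι (i ℤ.+ j)                          ≡⟨ cong₂ (λ x y → ι (x ℤ.+ y)) (ℤP.*-identityʳ i) (ℤP.*-identityʳ j) ⟨
  ι (i ℤ.* pos 1 ℤ.+ j ℤ.* pos 1)      ≡⟨ cong₂ ℚ._+_ (ι≡mkℚ i) (ι≡mkℚ j) ⟨
  ι i ℚ.+ ι j                          ∎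
  where open ≡-Reasoning

ι-injective : ∀ {i j} → ι i ≡ ι j → i ≡ j
ι-injective {i} {j} eq = cong ↥_ (trans (sym (ι≡mkℚ i)) (trans eq (ι≡mkℚ j)))

ι-mono-≤ : ∀ {i j} → i ℤ.≤ j → ι i ℚ.≤ ι j
ι-mono-≤ {i} {j} i≤j rewrite ι≡mkℚ i | ι≡mkℚ j =
  *≤* (subst₂ ℤ._≤_ (sym (ℤP.*-identityʳ i)) (sym (ℤP.*-identityʳ j)) i≤j)

ι-cancel-≤ : ∀ {i j} → ι i ℚ.≤ ι j → i ℤ.≤ j
ι-cancel-≤ {i} {j} ιi≤ιj rewrite ι≡mkℚ i | ι≡mkℚ j with ιi≤ιj
... | *≤* i≤j = subst₂ ℤ._≤_ (ℤP.*-identityʳ i) (ℤP.*-identityʳ j) i≤j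

ι-sum : ∀ {m} (f : Fin m → ℕ) → ι (pos (sum f)) ≡ ℚ∑.sum (λ k → ι (pos (f k)))
ι-sum {zero}  f = refl
ι-sum {suc m} f = begin
  ι (pos (f fzero + sum (f ∘ fsuc)))                ≡⟨ cong ι (ℤP.pos-+ (f fzero) (sum (f ∘ fsuc))) ⟩
  ι (pos (f fzero) ℤ.+ pos (sum (f ∘ fsuc)))        ≡⟨ ι-+ (pos (f fzero)) (pos (sum (f ∘ fsuc))) ⟩
  ι (pos (f fzero)) ℚ.+ ι (pos (sum (f ∘ fsuc)))    ≡⟨ cong (ι (pos (f fzero)) ℚ.+_) (ι-sum (f ∘ fsuc)) ⟩
  ι (pos (f fzero)) ℚ.+ ℚ∑.sum (λ k → ι (pos (f (fsuc k)))) ∎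
  where open ≡-Reasoning

sumℚ≡sum : ∀ k (w : Fin k → ℚ) → sumℚ k w ≡ ℚ∑.sum w
sumℚ≡sum zero    w = refl
sumℚ≡sum (suc k) w = cong (w fzero ℚ.+_) (sumℚ≡sum k (w ∘ fsuc))

ℚ∑-mono-≤ : ∀ {n} {f g : Fin n → ℚ} → (∀ i → f i ℚ.≤ g i) → ℚ∑.sum f ℚ.≤ ℚ∑.sum g
ℚ∑-mono-≤ {zero}  f≤g = ℚP.≤-refl
ℚ∑-mono-≤ {suc n} f≤g = ℚP.+-mono-≤ (f≤g fzero) (ℚ∑-mono-≤ (f≤g ∘ fsuc))

module _ {k} {w : Fin k → ℚ} (w≥0 : ∀ j → 0ℚ ℚ.≤ w j) (∑w≡1 : ℚ∑.sum w ≡ 1ℚ) where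

  private
    w*-mono-≤ : ∀ j {x y} → x ℚ.≤ y → w j ℚ.* x ℚ.≤ w j ℚ.* y
    w*-mono-≤ j = ℚP.*-monoˡ-≤-nonNeg (w j) {{ℚ.nonNegative (w≥0 j)}}

  mean-const : ∀ b → ℚ∑.sum (λ j → w j ℚ.* b) ≡ b
  mean-const b = trans (sym (ℚ∑.*-distribʳ-sum b w)) (trans (cong (ℚ._* b) ∑w≡1) (ℚP.*-identityˡ b))

  mean-≤ : ∀ {x : Fin k → ℚ} {b} → (∀ j → x j ℚ.≤ b) → ℚ∑.sum (λ j → w j ℚ.* x j) ℚ.≤ b
  mean-≤ {b = b} x≤b = ℚP.≤-trans (ℚ∑-mono-≤ (λ j → w*-mono-≤ j (x≤b j))) (ℚP.≤-reflexive (mean-const b))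

  mean-≥ : ∀ {x : Fin k → ℚ} {b} → (∀ j → b ℚ.≤ x j) → b ℚ.≤ ℚ∑.sum (λ j → w j ℚ.* x j)
  mean-≥ {b = b} b≤x = ℚP.≤-trans (ℚP.≤-reflexive (sym (mean-const b))) (ℚ∑-mono-≤ (λ j → w*-mono-≤ j (b≤x j)))

⟪_,_⟫ : ∀ {m} → (Fin m → ℚ) → Vec ℤ m → ℚ
⟪ a , v ⟫ = ℚ∑.sum (λ c → a c ℚ.* ι (lookup v c))

⟪⟫-mean : ∀ {m k} (p : Fin k → Vec ℤ m) (w : Fin k → ℚ) {α} →
          (∀ c → sumℚ k (λ j → w j ℚ.* ι (lookup (p j) c)) ≡ ι (lookup α c)) →
          ∀ a → ⟪ a , α ⟫ ≡ ℚ∑.sum (λ j → w j ℚ.* ⟪ a , p j ⟫)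
⟪⟫-mean {m} {k} p w {α} coords a = begin
  ℚ∑.sum (λ c → a c ℚ.* ι (lookup α c))
    ≡⟨ ℚ∑.sum-cong-≗ (λ c → cong (a c ℚ.*_) (trans (sym (coords c)) (sumℚ≡sum k _))) ⟩
  ℚ∑.sum (λ c → a c ℚ.* ℚ∑.sum (λ j → w j ℚ.* ι (lookup (p j) c)))
    ≡⟨ ℚ∑.sum-cong-≗ (λ c → ℚ∑.*-distribˡ-sum (a c) (λ j → w j ℚ.* ι (lookup (p j) c))) ⟩
  ℚ∑.sum (λ c → ℚ∑.sum (λ j → a c ℚ.* (w j ℚ.* ι (lookup (p j) c))))
    ≡⟨ ℚ∑.sum-cong-≗ (λ c → ℚ∑.sum-cong-≗ (λ j → x∙yz≈y∙xz (a c) (w j) (ι (lookup (p j) c)))) ⟩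
  ℚ∑.sum (λ c → ℚ∑.sum (λ j → w j ℚ.* (a c ℚ.* ι (lookup (p j) c))))
    ≡⟨ ℚ∑.∑-comm {m} {k} _ ⟩
  ℚ∑.sum (λ j → ℚ∑.sum (λ c → w j ℚ.* (a c ℚ.* ι (lookup (p j) c))))
    ≡⟨ ℚ∑.sum-cong-≗ (λ j → ℚ∑.*-distribˡ-sum (w j) (λ c → a c ℚ.* ι (lookup (p j) c))) ⟨
  ℚ∑.sum (λ j → w j ℚ.* ⟪ a , p j ⟫) ∎
  where open ≡-Reasoning

module _ {m} {S : Vec ℤ m → Set} where

  hull-≤ : ∀ a b → (∀ v → S v → ⟪ a , v ⟫ ℚ.≤ b) → ∀ α → InConvexHull S α → ⟪ a , α ⟫ ℚ.≤ b
  hull-≤ a b S≤b α (k , p , w , p∈S , w≥0 , ∑w≡1 , coords) =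
    subst (ℚ._≤ b) (sym (⟪⟫-mean p w {α} coords a))
      (mean-≤ w≥0 (trans (sym (sumℚ≡sum k w)) ∑w≡1) (λ j → S≤b (p j) (p∈S j)))

  hull-≡ : ∀ a b → (∀ v → S v → ⟪ a , v ⟫ ≡ b) → ∀ α → InConvexHull S α → ⟪ a , α ⟫ ≡ b
  hull-≡ a b S≡b α (k , p , w , p∈S , w≥0 , ∑w≡1 , coords) = begin
    ⟪ a , α ⟫                          ≡⟨ ⟪⟫-mean p w {α} coords a ⟩
    ℚ∑.sum (λ j → w j ℚ.* ⟪ a , p j ⟫) ≡⟨ ℚ∑.sum-cong-≗ (λ j → cong (w j ℚ.*_) (S≡b (p j) (p∈S j))) ⟩
    ℚ∑.sum (λ j → w j ℚ.* b)           ≡⟨ mean-const w≥0 (trans (sym (sumℚ≡sum k w)) ∑w≡1) b ⟩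
    b                                  ∎
    where open ≡-Reasoning

  hull-nonNegative : (∀ v → S v → ∀ c → ℤ.0ℤ ℤ.≤ lookup v c) →
                     ∀ α → InConvexHull S α → ∀ c → ℤ.0ℤ ℤ.≤ lookup α c
  hull-nonNegative S≥0 _ (k , p , w , p∈S , w≥0 , ∑w≡1 , coords) c =
    ι-cancel-≤ (subst (0ℚ ℚ.≤_) (trans (sym (sumℚ≡sum k (λ j → w j ℚ.* ι (lookup (p j) c)))) (coords c))
      (mean-≥ w≥0 (trans (sym (sumℚ≡sum k w)) ∑w≡1) (λ j → ι-mono-≤ (S≥0 (p j) (p∈S j) c))))

𝟙ℚ : ∀ {m} → (ℕ → Bool) → Fin m → ℚ
𝟙ℚ S k = if S (toℕ k) then 1ℚ else 0ℚ

⟪𝟙ℚ⟫-map-pos : ∀ {m} S (e : Vec ℕ m) → ⟪ 𝟙ℚ S , map pos e ⟫ ≡ ι (pos (∑∈ S m (lookup₀ e)))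
⟪𝟙ℚ⟫-map-pos {m} S e =
  trans (ℚ∑.sum-cong-≗ {m} term) (sym (ι-sum {m} (λ k → if S (toℕ k) then lookup₀ e (toℕ k) else 0)))
  where
  term : ∀ k → 𝟙ℚ S k ℚ.* ι (lookup (map pos e) k) ≡ ι (pos (if S (toℕ k) then lookup₀ e (toℕ k) else 0))
  term k rewrite lookup-map k pos e | lookup₀-toℕ e k with S (toℕ k)
  ... | true  = ℚP.*-identityˡ (ι (pos (lookup e k)))
  ... | false = ℚP.*-zeroˡ (ι (pos (lookup e k)))

hull-dominated : ∀ {m R ν} {S : Vec ℤ m → Set} →
  (∀ v → S v → Σ (Vec ℕ m) λ e → v ≡ map pos e × Dominated m R (lookup₀ e) ν) →
  ∀ α → InConvexHull S α → Σ (Vec ℕ m) λ e → α ≡ map pos e × Dominated m R (lookup₀ e) ν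
hull-dominated {m} {R} {ν} {S} S-dom α α∈hull = e , α≡e , record { partial-≤ = partial ; total-≡ = total }
  where
  e : Vec ℕ m
  e = map ℤ.∣_∣ α
  nonNegative : ∀ v → S v → ∀ c → ℤ.0ℤ ℤ.≤ lookup v c
  nonNegative v v∈S c with S-dom v v∈S
  ... | e′ , refl , _ = subst (ℤ.0ℤ ℤ.≤_) (sym (lookup-map c pos e′)) (ℤ.+≤+ z≤n)
  α≡e : α ≡ map pos e
  α≡e = lookup-extensionality α (map pos e) λ k → begin
    lookup α k                 ≡⟨ ℤP.0≤i⇒+∣i∣≡i (hull-nonNegative nonNegative α α∈hull k) ⟨
    pos ℤ.∣ lookup α k ∣       ≡⟨ cong pos (lookup-map k ℤ.∣_∣ α) ⟨
    pos (lookup e k)           ≡⟨ lookup-map k pos e ⟨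
    lookup (map pos e) k       ∎
    where open ≡-Reasoning
  value : ∀ T → ⟪ 𝟙ℚ T , α ⟫ ≡ ι (pos (∑∈ T m (lookup₀ e)))
  value T = trans (cong ⟪ 𝟙ℚ T ,_⟫ α≡e) (⟪𝟙ℚ⟫-map-pos T e)
  partial : ∀ T → ∑∈ T m (lookup₀ e) ≤ ∑< (card T m) ν
  partial T = ℤP.drop‿+≤+ (ι-cancel-≤ (subst (ℚ._≤ _) (value T) (hull-≤ (𝟙ℚ T) _ bound α α∈hull)))
    where
    bound : ∀ v → S v → ⟪ 𝟙ℚ T , v ⟫ ℚ.≤ ι (pos (∑< (card T m) ν))
    bound v v∈S with S-dom v v∈S
    ... | e′ , refl , dom = subst (ℚ._≤ _) (sym (⟪𝟙ℚ⟫-map-pos T e′)) (ι-mono-≤ (ℤ.+≤+ (partial-≤ dom T)))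
  total : ∑< m (lookup₀ e) ≡ ∑< R ν
  total = ℤP.+-injective (ι-injective
            (trans (sym (value (λ _ → true))) (hull-≡ (𝟙ℚ (λ _ → true)) _ equal α α∈hull)))
    where
    equal : ∀ v → S v → ⟪ 𝟙ℚ (λ _ → true) , v ⟫ ≡ ι (pos (∑< R ν))
    equal v v∈S with S-dom v v∈S
    ... | e′ , refl , dom = trans (⟪𝟙ℚ⟫-map-pos (λ _ → true) e′) (cong (ι ∘ pos) (total-≡ dom))

proposition2p9 : (N : ℕ) (lams : Fin N → Partition) →
    (m : ℕ) → m ≥ 1 → HasSNP (productExp m N lams)
proposition2p9 N lams m _ α α∈hull =
  let e , α≡e , dom = hull-dominated support-dominated α α∈hull
  in  subst (InSupport (productExp m N lams)) (sym α≡e) (dominated-inSupport e dom)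
  where open Product lams
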